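{- Let $G$ be a finite group and $A\leq G$. Then the following are equivalent: (a) $A$ is a perfect code of $G$; (b) there exists an inverse-closed left transversal of $A$ in $G$; (c) for each $g\in G$, there is an inverse-closed left transversal $Y$ of $A$ in $A\{g,g^{ -1}\}A$.
   Context: Graphs are finite, undirected and simple. A subset $C$ of the vertex set $V$ of a graph is a perfect code if every vertex in $V\setminus C$ is adjacent to exactly one vertex of $C$. For an inverse-closed subset $S\subseteq G\setminus\{e\}$, the Cayley graph $\mathrm{Cay}(G,S)$ has vertex set $G$ and edges $\{g,sg\}$ for $s\in S$, $g\in G$. A subset of $G$ is a perfect code of $G$ if it is a perfect code in some Cayley graph of $G$. If $B$ is a union of left cosets of $A$, a left transversal of $A$ in $B$ is a subset of $B$ containing exactly one element from each left coset of $A$ contained in $B$; a set $Y$ is inverse-closed if $Y^{ -1}=Y$. -}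

module Defs where

open import Data.Nat using (ℕ)
open import Data.Fin using (Fin)
open import Data.Fin.Subset using (Subset; _∈_; _∉_)
open import Data.Product using (Σ; ∃; _×_; _,_)
open import Data.Sum using (_⊎_)
open import Data.Unit using (⊤)
open import Relation.Nullary using (¬_)
open import Relation.Binary.PropositionalEquality using (_≡_)
open import Algebra.Structures using (IsGroup)

-- A finite group of order n: carrier Fin n, equality _≡_ (every finite group
-- is isomorphic to one of these).
record FiniteGroup (n : ℕ) : Set where
  field
    _∙_     : Fin n → Fin n → Fin n
    ε       : Fin n
    _⁻¹     : Fin n → Fin n
    isGroup : IsGroup _≡_ _∙_ ε _⁻¹
  infixl 7 _∙_
  infix 8 _⁻¹

module _ {n : ℕ} (G : FiniteGroup n) where
  open FiniteGroup G

  IsSubgroup : Subset n → Set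
  IsSubgroup A = (ε ∈ A)
               × (∀ x y → x ∈ A → y ∈ A → x ∙ y ∈ A)
               × (∀ x → x ∈ A → x ⁻¹ ∈ A)

  InverseClosed : Subset n → Set
  InverseClosed Y = ∀ y → y ∈ Y → y ⁻¹ ∈ Y

  -- Cayley graph Cay(G,S): edges {g, s g} for s ∈ S
  Adjacent : Subset n → Fin n → Fin n → Set
  Adjacent S g h = ∃ λ s → s ∈ S × h ≡ s ∙ g

  IsConnectionSet : Subset n → Set
  IsConnectionSet S = InverseClosed S × ε ∉ S

  IsPerfectCodeIn : Subset n → Subset n → Set
  IsPerfectCodeIn S C =
    ∀ v → v ∉ C →
      (∃ λ c → c ∈ C × Adjacent S v c)
      × (∀ c c' → c ∈ C → Adjacent S v c → c' ∈ C → Adjacent S v c' → c ≡ c')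

  IsPerfectCodeOfGroup : Subset n → Set
  IsPerfectCodeOfGroup C = ∃ λ S → IsConnectionSet S × IsPerfectCodeIn S C

  InLeftCoset : Subset n → Fin n → Fin n → Set
  InLeftCoset A g x = (g ⁻¹) ∙ x ∈ A

  -- Y is a left transversal of A in B (B a union of left cosets of A):
  -- Y ⊆ B and each left coset gA ⊆ B (g ∈ B) contains exactly one element of Y.
  IsLeftTransversalIn : Subset n → (Fin n → Set) → Subset n → Set
  IsLeftTransversalIn A B Y =
    (∀ y → y ∈ Y → B y)
    × (∀ g → B g →
         (∃ λ y → y ∈ Y × InLeftCoset A g y)
         × (∀ y y' → y ∈ Y → InLeftCoset A g y → y' ∈ Y → InLeftCoset A g y' → y ≡ y'))

  Whole : Fin n → Set
  Whole _ = ⊤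

  DoubleCosetPair : Subset n → Fin n → Fin n → Set
  DoubleCosetPair A g x =
    ∃ λ a → ∃ λ b → a ∈ A × b ∈ A × (x ≡ a ∙ g ∙ b ⊎ x ≡ a ∙ g ⁻¹ ∙ b)

{-# OPTIONS --safe #-}
-- For c ∈ A, the adjacency c = s v says exactly that s⁻¹ lies in the left coset vA, since
-- c⁻¹ = v⁻¹ s⁻¹.  So A is a perfect code in Cay(G,S) iff S meets every left coset vA ≠ A in
-- exactly one element, i.e. iff (S ∖ A) ∪ {e} is a left transversal of A; conversely a
-- transversal Y yields the connection set Y ∖ A, and inverse-closedness survives both ways.
-- The relation "x ∈ A{g,g⁻¹}A" is an equivalence whose classes are unions of left cosets of A
-- and closed under inversion.  An inverse-closed transversal of G therefore restricts to one of
-- every class, and conversely inverse-closed transversals of the classes, chosen once per class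
-- (through its least element), glue to one of G.
module Submission where

open import Defs
open import Level using (0ℓ)
open import Data.Nat using (ℕ; suc; s<s⁻¹)
open import Data.Fin using (Fin; zero; suc; _<_; _≟_)
open import Data.Fin.Properties using (<-cmp; any?)
open import Data.Fin.Subset using (Subset; _∈_; _∉_)
open import Data.Fin.Subset.Properties using (_∈?_)
open import Data.Vec using (tabulate)
open import Data.Vec.Properties using (lookup∘tabulate; []=⇒lookup; lookup⇒[]=)
open import Data.Product using (∃; ∃₂; _×_; _,_; proj₁; proj₂)
open import Data.Sum using (_⊎_; inj₁; inj₂)
open import Data.Unit using (tt)
open import Function using (_∘_)
open import Function.Bundles using (_⇔_; mk⇔; Equivalence)
open import Relation.Nullary using (¬_; yes; no; does; ¬?; contradiction)
open import Relation.Nullary.Decidable using (dec-true; _×-dec_; _⊎-dec_)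
open import Relation.Unary using (Pred; Decidable; Satisfiable)
open import Relation.Binary using (Rel; tri<; tri≈; tri>; IsEquivalence)
import Relation.Binary as B
open import Relation.Binary.PropositionalEquality
open import Algebra.Bundles using (Group)
open import Algebra.Structures using (IsGroup)
import Algebra.Properties.Group as GroupProperties

module _ {n : ℕ} {P : Pred (Fin n) 0ℓ} (P? : Decidable P) where

  toSubset : Subset n
  toSubset = tabulate (does ∘ P?)

  ∈-toSubset⁺ : ∀ {x} → P x → x ∈ toSubset
  ∈-toSubset⁺ {x} px =
    lookup⇒[]= x toSubset (trans (lookup∘tabulate _ x) (dec-true (P? x) px))

  ∈-toSubset⁻ : ∀ {x} → x ∈ toSubset → P x
  ∈-toSubset⁻ {x} x∈ with P? x | trans (sym (lookup∘tabulate _ x)) ([]=⇒lookup x∈)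
  ... | yes px | _  = px
  ... | no _   | ()

IsLeast : ∀ {n} → Pred (Fin n) 0ℓ → Fin n → Set
IsLeast P i = P i × (∀ {j} → j < i → ¬ P j)

least : ∀ {n} {P : Pred (Fin n) 0ℓ} → Decidable P → Satisfiable P → ∃ (IsLeast P)
least {suc n} P? _ with P? zero
... | yes p₀ = zero , p₀ , λ ()
least {suc n} P? (zero , p₀)  | no ¬p₀ = contradiction p₀ ¬p₀
least {suc n} P? (suc i , pᵢ) | no ¬p₀ with least (P? ∘ suc) (i , pᵢ)
... | j , pⱼ , below = suc j , pⱼ , λ { {zero} _ → ¬p₀ ; {suc k} k<j → below (s<s⁻¹ k<j) }

least-unique : ∀ {n} {P : Pred (Fin n) 0ℓ} {i j} → IsLeast P i → IsLeast P j → i ≡ j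
least-unique {i = i} {j} (pᵢ , i-least) (pⱼ , j-least) with <-cmp i j
... | tri< i<j _ _ = contradiction pᵢ (j-least i<j)
... | tri≈ _ i≡j _ = i≡j
... | tri> _ _ j<i = contradiction pⱼ (i-least j<i)

module _ {n : ℕ} (G : FiniteGroup n) (A : Subset n) where
  open FiniteGroup G

  MeetsCosetOnce : Subset n → Fin n → Set
  MeetsCosetOnce Y g =
    (∃ λ y → y ∈ Y × InLeftCoset G A g y)
    × (∀ y y' → y ∈ Y → InLeftCoset G A g y → y' ∈ Y → InLeftCoset G A g y' → y ≡ y')

  InverseClosedTransversal : (Fin n → Set) → Set
  InverseClosedTransversal B = ∃ λ Y → InverseClosed G Y × IsLeftTransversalIn G A B Y

  module ClassTransversals
    {_~_ : Rel (Fin n) 0ℓ} (~-isEquivalence : IsEquivalence _~_) (_~?_ : B.Decidable _~_)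
    (coset⊆class : ∀ {g y} → InLeftCoset G A g y → g ~ y) (~-⁻¹ : ∀ g → g ~ (g ⁻¹))
    where
    open IsEquivalence ~-isEquivalence renaming (refl to ~-refl; sym to ~-sym; trans to ~-trans)

    restrictTransversal :
      InverseClosedTransversal (Whole G) → ∀ g → InverseClosedTransversal (g ~_)
    restrictTransversal (Y , Y-closed , _ , Y-transversal) g =
      Yg , Yg-closed , Yg⊆[g] , Yg-transversal
      where
      Yg? : Decidable (λ y → y ∈ Y × g ~ y)
      Yg? y = (y ∈? Y) ×-dec (g ~? y)

      Yg = toSubset Yg?

      Yg-closed : InverseClosed G Yg
      Yg-closed y y∈Yg with ∈-toSubset⁻ Yg? y∈Yg
      ... | y∈Y , g~y = ∈-toSubset⁺ Yg? (Y-closed y y∈Y , ~-trans g~y (~-⁻¹ y))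

      Yg⊆[g] : ∀ y → y ∈ Yg → g ~ y
      Yg⊆[g] y = proj₂ ∘ ∈-toSubset⁻ Yg?

      Yg⊆Y : ∀ {y} → y ∈ Yg → y ∈ Y
      Yg⊆Y = proj₁ ∘ ∈-toSubset⁻ Yg?

      Yg-transversal : ∀ h → g ~ h → MeetsCosetOnce Yg h
      Yg-transversal h g~h with Y-transversal h tt
      ... | (y₀ , y₀∈Y , y₀∈hA) , unique =
        (y₀ , ∈-toSubset⁺ Yg? (y₀∈Y , ~-trans g~h (coset⊆class y₀∈hA)) , y₀∈hA) ,
        λ y y' y∈ y∈hA y'∈ y'∈hA → unique y y' (Yg⊆Y y∈) y∈hA (Yg⊆Y y'∈) y'∈hA

    glueTransversals :
      (∀ g → InverseClosedTransversal (g ~_)) → InverseClosedTransversal (Whole G)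
    glueTransversals T = Y , Y-closed , (λ _ _ → tt) , Y-transversal
      where
      rep : Fin n → Fin n
      rep g = proj₁ (least (g ~?_) (g , ~-refl))

      rep-least : ∀ g → IsLeast (g ~_) (rep g)
      rep-least g = proj₂ (least (g ~?_) (g , ~-refl))

      rep-cong : ∀ {g h} → g ~ h → rep g ≡ rep h
      rep-cong {g} {h} g~h with rep-least g
      ... | g~r , below =
        least-unique (~-trans (~-sym g~h) g~r , λ j<r h~j → below j<r (~-trans g~h h~j))
                     (rep-least h)

      Ys : Fin n → Subset n
      Ys g = proj₁ (T (rep g))

      Ys-cong : ∀ {g h} → g ~ h → Ys g ≡ Ys h
      Ys-cong = cong (proj₁ ∘ T) ∘ rep-cong

      Ys-closed : ∀ g → InverseClosed G (Ys g)
      Ys-closed g = proj₁ (proj₂ (T (rep g)))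

      Ys-meets : ∀ g → MeetsCosetOnce (Ys g) g
      Ys-meets g = proj₂ (proj₂ (proj₂ (T (rep g)))) g (~-sym (proj₁ (rep-least g)))

      Y? : Decidable (λ y → y ∈ Ys y)
      Y? y = y ∈? Ys y

      Y = toSubset Y?

      ∈Y⇔∈Ys : ∀ {g y} → g ~ y → y ∈ Y ⇔ y ∈ Ys g
      ∈Y⇔∈Ys {g} {y} g~y = mk⇔
        (λ y∈Y → subst (y ∈_) (sym (Ys-cong g~y)) (∈-toSubset⁻ Y? y∈Y))
        (λ y∈Ys → ∈-toSubset⁺ Y? (subst (y ∈_) (Ys-cong g~y) y∈Ys))

      Y-closed : InverseClosed G Y
      Y-closed y y∈Y =
        Equivalence.from (∈Y⇔∈Ys (~-⁻¹ y)) (Ys-closed y y (∈-toSubset⁻ Y? y∈Y))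

      Y-transversal : ∀ g → Whole G g → MeetsCosetOnce Y g
      Y-transversal g _ with Ys-meets g
      ... | (y₀ , y₀∈Ys , y₀∈gA) , unique =
        (y₀ , Equivalence.from (∈Y⇔∈Ys (coset⊆class y₀∈gA)) y₀∈Ys , y₀∈gA) ,
        λ y y' y∈Y y∈gA y'∈Y y'∈gA →
          unique y y' (to y∈gA y∈Y) y∈gA (to y'∈gA y'∈Y) y'∈gA
        where
        to : ∀ {y} → InLeftCoset G A g y → y ∈ Y → y ∈ Ys g
        to y∈gA = Equivalence.to (∈Y⇔∈Ys (coset⊆class y∈gA))

module Subgroup {n : ℕ} (G : FiniteGroup n) {A : Subset n} (A≤G : IsSubgroup G A) where
  open FiniteGroup G
  open IsGroup isGroup using (assoc; identityˡ; identityʳ; _\\_)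

  group : Group 0ℓ 0ℓ
  group = record { isGroup = isGroup }

  open GroupProperties group
    using ( ⁻¹-involutive; ⁻¹-injective; ⁻¹-anti-homo-∙; ε⁻¹≈ε; ∙-cancelʳ
          ; y≈x\\z; x≈z//y; \\-leftDividesˡ; \\-leftDividesʳ)
  open ≡-Reasoning

  ε∈A : ε ∈ A
  ε∈A = proj₁ A≤G

  ∙-∈ : ∀ {x y} → x ∈ A → y ∈ A → x ∙ y ∈ A
  ∙-∈ = proj₁ (proj₂ A≤G) _ _

  ⁻¹-∈ : ∀ {x} → x ∈ A → x ⁻¹ ∈ A
  ⁻¹-∈ = proj₂ (proj₂ A≤G) _

  ⁻¹-∈⁻ : ∀ {x} → x ⁻¹ ∈ A → x ∈ A
  ⁻¹-∈⁻ {x} x⁻¹∈A = subst (_∈ A) (⁻¹-involutive x) (⁻¹-∈ x⁻¹∈A)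

  ∙-∈⁻ : ∀ {x y} → x ∈ A → x ∙ y ∈ A → y ∈ A
  ∙-∈⁻ {x} {y} x∈A xy∈A = subst (_∈ A) (\\-leftDividesʳ x y) (∙-∈ (⁻¹-∈ x∈A) xy∈A)

  ∙-⁻¹-∈ : ∀ {x y} → x ∙ y ∈ A → y ⁻¹ ∙ x ⁻¹ ∈ A
  ∙-⁻¹-∈ {x} {y} xy∈A = subst (_∈ A) (⁻¹-anti-homo-∙ x y) (⁻¹-∈ xy∈A)

  coset-sym : ∀ {g y} → InLeftCoset G A g y → InLeftCoset G A y g
  coset-sym {g} {y} y∈gA = subst (λ h → y ⁻¹ ∙ h ∈ A) (⁻¹-involutive g) (∙-⁻¹-∈ y∈gA)

  perfectCode⇒transversal : IsPerfectCodeOfGroup G A → InverseClosedTransversal G A (Whole G)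
  perfectCode⇒transversal (S , (S-closed , _) , perfect) =
    Y , Y-closed , (λ _ _ → tt) , Y-transversal
    where
    Y? : Decidable (λ y → y ≡ ε ⊎ (y ∈ S × y ∉ A))
    Y? y = (y ≟ ε) ⊎-dec ((y ∈? S) ×-dec ¬? (y ∈? A))

    Y = toSubset Y?

    Y-closed : InverseClosed G Y
    Y-closed y y∈Y with ∈-toSubset⁻ Y? y∈Y
    ... | inj₁ refl          = ∈-toSubset⁺ Y? (inj₁ ε⁻¹≈ε)
    ... | inj₂ (y∈S , y∉A) = ∈-toSubset⁺ Y? (inj₂ (S-closed y y∈S , y∉A ∘ ⁻¹-∈⁻))

    Y∩A⊆ε : ∀ {y} → y ∈ Y → y ∈ A → y ≡ ε
    Y∩A⊆ε y∈Y y∈A with ∈-toSubset⁻ Y? y∈Y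
    ... | inj₁ y≡ε       = y≡ε
    ... | inj₂ (_ , y∉A) = contradiction y∈A y∉A

    Y∖A⊆S : ∀ {y} → y ∈ Y → y ∉ A → y ∈ S
    Y∖A⊆S y∈Y y∉A with ∈-toSubset⁻ Y? y∈Y
    ... | inj₁ refl      = contradiction ε∈A y∉A
    ... | inj₂ (y∈S , _) = y∈S

    Y-transversal : ∀ g → Whole G g → MeetsCosetOnce G A Y g
    Y-transversal g _ with g ∈? A
    ... | yes g∈A = (ε , ∈-toSubset⁺ Y? (inj₁ refl) , ∙-∈ (⁻¹-∈ g∈A) ε∈A) ,
                    λ y y' y∈Y y∈gA y'∈Y y'∈gA → trans (in-A y∈Y y∈gA) (sym (in-A y'∈Y y'∈gA))
      where
      in-A : ∀ {y} → y ∈ Y → InLeftCoset G A g y → y ≡ ε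
      in-A y∈Y y∈gA = Y∩A⊆ε y∈Y (∙-∈⁻ (⁻¹-∈ g∈A) y∈gA)
    ... | no g∉A = neighbour (proj₁ (perfect g g∉A)) , unique
      where
      outside-A : ∀ {y} → InLeftCoset G A g y → y ∉ A
      outside-A y∈gA y∈A = g∉A (∙-∈⁻ (⁻¹-∈ y∈A) (coset-sym y∈gA))

      neighbour : (∃ λ c → c ∈ A × Adjacent G S g c) → ∃ λ y → y ∈ Y × InLeftCoset G A g y
      neighbour (_ , sg∈A , s , s∈S , refl) =
        s ⁻¹ ,
        ∈-toSubset⁺ Y? (inj₂ (S-closed s s∈S , λ s⁻¹∈A → g∉A (∙-∈⁻ (⁻¹-∈⁻ s⁻¹∈A) sg∈A))) ,
        ∙-⁻¹-∈ sg∈A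

      adjacent : ∀ {y} → y ∈ Y → InLeftCoset G A g y → Adjacent G S g (y ⁻¹ ∙ g)
      adjacent y∈Y y∈gA = _ , S-closed _ (Y∖A⊆S y∈Y (outside-A y∈gA)) , refl

      unique : ∀ y y' → y ∈ Y → InLeftCoset G A g y → y' ∈ Y → InLeftCoset G A g y' → y ≡ y'
      unique y y' y∈Y y∈gA y'∈Y y'∈gA = ⁻¹-injective (∙-cancelʳ g _ _
        (proj₂ (perfect g g∉A) _ _ (coset-sym y∈gA) (adjacent y∈Y y∈gA)
                                   (coset-sym y'∈gA) (adjacent y'∈Y y'∈gA)))

  transversal⇒perfectCode : InverseClosedTransversal G A (Whole G) → IsPerfectCodeOfGroup G A
  transversal⇒perfectCode (Y , Y-closed , _ , Y-transversal) = S , (S-closed , ε∉S) , perfect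
    where
    S? : Decidable (λ y → y ∈ Y × y ∉ A)
    S? y = (y ∈? Y) ×-dec ¬? (y ∈? A)

    S = toSubset S?

    S-closed : InverseClosed G S
    S-closed y y∈S with ∈-toSubset⁻ S? y∈S
    ... | y∈Y , y∉A = ∈-toSubset⁺ S? (Y-closed y y∈Y , y∉A ∘ ⁻¹-∈⁻)

    ε∉S : ε ∉ S
    ε∉S ε∈S = proj₂ (∈-toSubset⁻ S? ε∈S) ε∈A

    perfect : IsPerfectCodeIn G S A
    perfect v v∉A = neighbour (proj₁ (Y-transversal v tt)) , unique
      where
      neighbour : (∃ λ y → y ∈ Y × InLeftCoset G A v y) → ∃ λ c → c ∈ A × Adjacent G S v c
      neighbour (y , y∈Y , y∈vA) =
        y ⁻¹ ∙ v , coset-sym y∈vA , y ⁻¹ ,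
        ∈-toSubset⁺ S? (Y-closed y y∈Y , λ y⁻¹∈A → v∉A (∙-∈⁻ y⁻¹∈A (coset-sym y∈vA))) , refl

      unique : ∀ c c' → c ∈ A → Adjacent G S v c → c' ∈ A → Adjacent G S v c' → c ≡ c'
      unique _ _ sv∈A (s , s∈S , refl) s'v∈A (s' , s'∈S , refl) = cong (_∙ v) (⁻¹-injective
        (proj₂ (Y-transversal v tt) _ _ (inverse∈Y s∈S) (∙-⁻¹-∈ sv∈A)
                                        (inverse∈Y s'∈S) (∙-⁻¹-∈ s'v∈A)))
        where
        inverse∈Y : ∀ {s} → s ∈ S → s ⁻¹ ∈ Y
        inverse∈Y s∈S = Y-closed _ (proj₁ (∈-toSubset⁻ S? s∈S))

  InDoubleCoset : Fin n → Fin n → Set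
  InDoubleCoset g x = ∃₂ λ a b → a ∈ A × b ∈ A × x ≡ a ∙ g ∙ b

  ≡ε∙_∙ε : ∀ x → x ≡ ε ∙ x ∙ ε
  ≡ε∙ x ∙ε = sym (trans (identityʳ _) (identityˡ x))

  doubleCoset-refl : ∀ g → InDoubleCoset g g
  doubleCoset-refl g = ε , ε , ε∈A , ε∈A , ≡ε∙ g ∙ε

  doubleCoset-sym : ∀ {g x} → InDoubleCoset g x → InDoubleCoset x g
  doubleCoset-sym {g} {x} (a , b , a∈A , b∈A , x≡agb) =
    a ⁻¹ , b ⁻¹ , ⁻¹-∈ a∈A , ⁻¹-∈ b∈A , (begin
    g                  ≡⟨ y≈x\\z a g _ (x≈z//y (a ∙ g) b x (sym x≡agb)) ⟩
    a \\ (x ∙ b ⁻¹)    ≡⟨ assoc _ _ _ ⟨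
    a ⁻¹ ∙ x ∙ b ⁻¹    ∎)

  doubleCoset-trans : ∀ {g x y} → InDoubleCoset g x → InDoubleCoset x y → InDoubleCoset g y
  doubleCoset-trans {g} (a , b , a∈A , b∈A , refl) (c , d , c∈A , d∈A , refl) =
    c ∙ a , b ∙ d , ∙-∈ c∈A a∈A , ∙-∈ b∈A d∈A , (begin
      c ∙ (a ∙ g ∙ b) ∙ d    ≡⟨ cong (_∙ d) (assoc c (a ∙ g) b) ⟨
      c ∙ (a ∙ g) ∙ b ∙ d    ≡⟨ cong (λ h → h ∙ b ∙ d) (assoc c a g) ⟨
      c ∙ a ∙ g ∙ b ∙ d      ≡⟨ assoc _ b d ⟩
      c ∙ a ∙ g ∙ (b ∙ d)    ∎)

  doubleCoset-⁻¹ : ∀ {g x} → InDoubleCoset g x → InDoubleCoset (g ⁻¹) (x ⁻¹)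
  doubleCoset-⁻¹ {g} (a , b , a∈A , b∈A , refl) =
    b ⁻¹ , a ⁻¹ , ⁻¹-∈ b∈A , ⁻¹-∈ a∈A , (begin
    (a ∙ g ∙ b) ⁻¹           ≡⟨ ⁻¹-anti-homo-∙ _ b ⟩
    b ⁻¹ ∙ (a ∙ g) ⁻¹        ≡⟨ cong (b ⁻¹ ∙_) (⁻¹-anti-homo-∙ a g) ⟩
    b ⁻¹ ∙ (g ⁻¹ ∙ a ⁻¹)     ≡⟨ assoc _ _ _ ⟨
    b ⁻¹ ∙ g ⁻¹ ∙ a ⁻¹       ∎)

  doubleCoset-⁻¹⁻¹ : ∀ {g x} → InDoubleCoset (g ⁻¹ ⁻¹) x → InDoubleCoset g x
  doubleCoset-⁻¹⁻¹ {x = x} = subst (λ h → InDoubleCoset h x) (⁻¹-involutive _)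

  doubleCosetPair⇒ : ∀ {g x} →
    DoubleCosetPair G A g x → InDoubleCoset g x ⊎ InDoubleCoset (g ⁻¹) x
  doubleCosetPair⇒ (a , b , a∈A , b∈A , inj₁ x≡agb)   = inj₁ (a , b , a∈A , b∈A , x≡agb)
  doubleCosetPair⇒ (a , b , a∈A , b∈A , inj₂ x≡ag⁻¹b) = inj₂ (a , b , a∈A , b∈A , x≡ag⁻¹b)

  ⇒doubleCosetPair : ∀ {g x} →
    InDoubleCoset g x ⊎ InDoubleCoset (g ⁻¹) x → DoubleCosetPair G A g x
  ⇒doubleCosetPair (inj₁ (a , b , a∈A , b∈A , x≡agb))   = a , b , a∈A , b∈A , inj₁ x≡agb
  ⇒doubleCosetPair (inj₂ (a , b , a∈A , b∈A , x≡ag⁻¹b)) = a , b , a∈A , b∈A , inj₂ x≡ag⁻¹b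

  doubleCosetPair-isEquivalence : IsEquivalence (DoubleCosetPair G A)
  doubleCosetPair-isEquivalence = record
    { refl  = ⇒doubleCosetPair (inj₁ (doubleCoset-refl _))
    ; sym   = ⇒doubleCosetPair ∘ pair-sym ∘ doubleCosetPair⇒
    ; trans = λ g~x x~y →
        ⇒doubleCosetPair (pair-trans (doubleCosetPair⇒ g~x) (doubleCosetPair⇒ x~y))
    }
    where
    Pair : Fin n → Fin n → Set
    Pair g x = InDoubleCoset g x ⊎ InDoubleCoset (g ⁻¹) x

    pair-sym : ∀ {g x} → Pair g x → Pair x g
    pair-sym (inj₁ d) = inj₁ (doubleCoset-sym d)
    pair-sym (inj₂ d) = inj₂ (doubleCoset-sym (doubleCoset-⁻¹⁻¹ (doubleCoset-⁻¹ d)))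

    pair-trans : ∀ {g x y} → Pair g x → Pair x y → Pair g y
    pair-trans (inj₁ d) (inj₁ e) = inj₁ (doubleCoset-trans d e)
    pair-trans (inj₂ d) (inj₁ e) = inj₂ (doubleCoset-trans d e)
    pair-trans (inj₁ d) (inj₂ e) = inj₂ (doubleCoset-trans (doubleCoset-⁻¹ d) e)
    pair-trans (inj₂ d) (inj₂ e) = inj₁ (doubleCoset-⁻¹⁻¹ (doubleCoset-trans (doubleCoset-⁻¹ d) e))

  doubleCosetPair? : B.Decidable (DoubleCosetPair G A)
  doubleCosetPair? g x = any? λ a → any? λ b →
    (a ∈? A) ×-dec (b ∈? A) ×-dec ((x ≟ a ∙ g ∙ b) ⊎-dec (x ≟ a ∙ g ⁻¹ ∙ b))

  coset⊆doubleCosetPair : ∀ {g y} → InLeftCoset G A g y → DoubleCosetPair G A g y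
  coset⊆doubleCosetPair {g} {y} y∈gA = ε , g \\ y , ε∈A , y∈gA , inj₁ (begin
    y                 ≡⟨ \\-leftDividesˡ g y ⟨
    g ∙ (g \\ y)      ≡⟨ cong (_∙ (g \\ y)) (identityˡ g) ⟨
    ε ∙ g ∙ (g \\ y)  ∎)

  doubleCosetPair-⁻¹ : ∀ g → DoubleCosetPair G A g (g ⁻¹)
  doubleCosetPair-⁻¹ g = ε , ε , ε∈A , ε∈A , inj₂ ≡ε∙ g ⁻¹ ∙ε

corollary1p7 : ∀ {n : ℕ} (G : FiniteGroup n) (A : Subset n) → IsSubgroup G A →
    let a = IsPerfectCodeOfGroup G A
        b = ∃ λ Y → InverseClosed G Y × IsLeftTransversalIn G A (Whole G) Y
        c = ∀ (g : Fin n) → ∃ λ Y → InverseClosed G Y × IsLeftTransversalIn G A (DoubleCosetPair G A g) Y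
    in (a ⇔ b) × (b ⇔ c)
corollary1p7 G A A≤G =
  mk⇔ perfectCode⇒transversal transversal⇒perfectCode , mk⇔ restrictTransversal glueTransversals
  where
  open Subgroup G A≤G
  open ClassTransversals G A doubleCosetPair-isEquivalence doubleCosetPair?
                         coset⊆doubleCosetPair doubleCosetPair-⁻¹
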